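{- Let $G_I$ be a connected interval graph with at least two vertices and interval model $I=\{I_1,\dots,I_n\}$, $I_i=[a_i,b_i]$, where no two intervals share an endpoint, and let $I'$ and the digraph $D$ be as described in the context. Let $D_S$ be a semitotal dominating set of $G_I$ such that no interval of the associated set $S=\{I_i: i\in D_S\}$ is properly contained within any interval in $I$, and write $D_S=\{i_1,\dots,i_k\}$ with $i_1<\dots<i_k$. Then $D_S$ corresponds to a directed path from vertex $0$ to vertex $n+1$ in $D$ which does not include any two consecutive unmarked arcs of $D$, namely the path $0,i_1,i_2,\dots,i_k,n+1$.
   Context: Vertex $i$ of $G_I$ corresponds to $I_i$; two vertices are adjacent iff their intervals intersect (overlap). A set $D_S$ of vertices is a semitotal dominating set if it is dominating and each vertex of $D_S$ is at distance at most $2$ from another vertex of $D_S$. Let $I'=I\cup\{I_0,I_{n+1}\}$ with $I_0=[a_0,b_0]$, $I_{n+1}=[a_{n+1},b_{n+1}]$, $b_0<\min_{k\in[n]}a_k$ and $a_{n+1}>\max_{k\in[n]}b_k$, and suppose the intervals are indexed so that $a_0<a_1<\dots<a_n<a_{n+1}$. The digraph $D=(V,A)$ has vertex set $V=\{k: I_k\in I' \text{ and } I_k \text{ is not contained in any other interval of } I'\}$ and arc set $A=A_1\cup A_2$ (disjoint), where: for intervals $I_i,I_j$ (indices in $V$) with $1\le i<j\le n$ that overlap, $(i,j)\in A_1$; for non-overlapping $I_i,I_j$ with $0\le i<j\le n+1$ (so $b_i<a_j$) such that there is no interval $I_h\in I'$ with $b_i<a_h$ and $b_h<a_j$, $(i,j)\in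 A_2$. An arc $(i,j)\in A_2$ is marked if some interval $I_h\in I'$ overlaps both $I_i$ and $I_j$, and unmarked otherwise. Paths are directed. -}

module Defs where

open import Data.Nat using (ℕ; zero; suc; _+_; _≤_; _<_)
open import Data.Product using (Σ; _×_; ∃)
open import Data.Sum using (_⊎_)
open import Data.List using (List; []; _∷_; _++_)
open import Data.List.Membership.Propositional using (_∈_)
open import Relation.Nullary using (¬_)
open import Relation.Binary.PropositionalEquality using (_≡_; _≢_)

-- An interval family is given by left endpoints a and right endpoints b,
-- indexed by ℕ: I_k = [a k , b k].  Indices 1..n form the model I;
-- indices 0 and n+1 are the two added intervals I_0, I_{n+1} of I'.

InI : ℕ → ℕ → Set
InI n k = 1 ≤ k × k ≤ n

InI' : ℕ → ℕ → Set
InI' n k = k ≤ suc n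

Overlap : (a b : ℕ → ℕ) → ℕ → ℕ → Set
Overlap a b i j = a i ≤ b j × a j ≤ b i

Contained : (a b : ℕ → ℕ) → ℕ → ℕ → Set
Contained a b i j = a j ≤ a i × b i ≤ b j

Adj : ℕ → (a b : ℕ → ℕ) → ℕ → ℕ → Set
Adj n a b i j = InI n i × InI n j × i ≢ j × Overlap a b i j

data Reach (n : ℕ) (a b : ℕ → ℕ) : ℕ → ℕ → Set where
  here : ∀ {i} → InI n i → Reach n a b i i
  step : ∀ {i j k} → Adj n a b i j → Reach n a b j k → Reach n a b i k

Connected : ℕ → (a b : ℕ → ℕ) → Set
Connected n a b = ∀ i j → InI n i → InI n j → Reach n a b i j

Dist≤2 : ℕ → (a b : ℕ → ℕ) → ℕ → ℕ → Set
Dist≤2 n a b u w = Adj n a b u w ⊎ (∃ λ v → Adj n a b u v × Adj n a b v w)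

Subset : ℕ → List ℕ → Set
Subset n DS = ∀ i → i ∈ DS → InI n i

Dominating : ℕ → (a b : ℕ → ℕ) → List ℕ → Set
Dominating n a b DS =
  ∀ v → InI n v → v ∈ DS ⊎ (∃ λ u → u ∈ DS × Adj n a b u v)

SemitotalDominating : ℕ → (a b : ℕ → ℕ) → List ℕ → Set
SemitotalDominating n a b DS =
  Subset n DS × Dominating n a b DS ×
  (∀ u → u ∈ DS → ∃ λ w → w ∈ DS × w ≢ u × Dist≤2 n a b u w)

data Increasing : List ℕ → Set where
  []  : Increasing []
  [_] : ∀ x → Increasing (x ∷ [])
  _∷_ : ∀ {x y xs} → x < y → Increasing (y ∷ xs) → Increasing (x ∷ y ∷ xs)

InV : ℕ → (a b : ℕ → ℕ) → ℕ → Set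
InV n a b k = InI' n k × (∀ h → InI' n h → h ≢ k → ¬ Contained a b k h)

ArcA₁ : ℕ → (a b : ℕ → ℕ) → ℕ → ℕ → Set
ArcA₁ n a b i j =
  InV n a b i × InV n a b j × 1 ≤ i × i < j × j ≤ n × Overlap a b i j

ArcA₂ : ℕ → (a b : ℕ → ℕ) → ℕ → ℕ → Set
ArcA₂ n a b i j =
  InV n a b i × InV n a b j × i < j × j ≤ suc n × b i < a j ×
  (∀ h → InI' n h → ¬ (b i < a h × b h < a j))

Arc : ℕ → (a b : ℕ → ℕ) → ℕ → ℕ → Set
Arc n a b i j = ArcA₁ n a b i j ⊎ ArcA₂ n a b i j

Marked : ℕ → (a b : ℕ → ℕ) → ℕ → ℕ → Set
Marked n a b i j = ∃ λ h → InI' n h × Overlap a b h i × Overlap a b h j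

Unmarked : ℕ → (a b : ℕ → ℕ) → ℕ → ℕ → Set
Unmarked n a b i j = ArcA₂ n a b i j × ¬ Marked n a b i j

data IsPath (n : ℕ) (a b : ℕ → ℕ) : List ℕ → Set where
  single : ∀ {x} → InV n a b x → IsPath n a b (x ∷ [])
  cons   : ∀ {x y xs} → Arc n a b x y → IsPath n a b (y ∷ xs) →
           IsPath n a b (x ∷ y ∷ xs)

data NoTwoUnmarked (n : ℕ) (a b : ℕ → ℕ) : List ℕ → Set where
  nil   : NoTwoUnmarked n a b []
  one   : ∀ x → NoTwoUnmarked n a b (x ∷ [])
  two   : ∀ x y → NoTwoUnmarked n a b (x ∷ y ∷ [])
  cons  : ∀ {x y z xs} → ¬ (Unmarked n a b x y × Unmarked n a b y z) →
          NoTwoUnmarked n a b (y ∷ z ∷ xs) →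
          NoTwoUnmarked n a b (x ∷ y ∷ z ∷ xs)

WellFormed : ℕ → (a b : ℕ → ℕ) → Set
WellFormed n a b = ∀ k → InI' n k → a k ≤ b k

DistinctEndpoints : ℕ → (a b : ℕ → ℕ) → Set
DistinctEndpoints n a b = ∀ i j → InI n i → InI n j → i ≢ j →
  a i ≢ a j × a i ≢ b j × b i ≢ b j

SortedLeft : ℕ → (a : ℕ → ℕ) → Set
SortedLeft n a = ∀ i j → InI' n i → InI' n j → i < j → a i < a j

Sentinels : ℕ → (a b : ℕ → ℕ) → Set
Sentinels n a b = ∀ k → InI n k → b 0 < a k × b k < a (suc n)

module Submission where

-- Call 0, n+1 and the members of DS the anchors.  The proof rests on three
-- local facts about two or three anchors that are consecutive, i.e. have no
-- member of DS strictly between them: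
--   * every anchor is a vertex of D (it is contained in no other interval);
--   * consecutive anchors p < q form an arc: an A₁-arc if I_p and I_q
--     overlap, and otherwise an A₂-arc, because an interval lying in the gap
--     between I_p and I_q would be undominated by DS;
--   * for consecutive anchors x < y < z with y ∈ DS, the semitotal partner
--     w of y lies at or before x or at or after z, and the distance-2 path
--     from y to w passes through an interval marking the arc (x,y) or (y,z).
-- The theorem follows by walking along the list 0 ∷ DS ++ [n+1], carrying
-- the invariant that every member of DS is already visited or still ahead.

open import Defs
open import Data.Nat using (ℕ; zero; suc; _≤_; _<_; z≤n; s≤s; _≤?_)
open import Data.Nat.Properties
open import Data.List using (List; []; _∷_; _++_)
open import Data.List.Membership.Propositional using (_∈_)
open import Data.List.Relation.Unary.Any using (here; there)
open import Data.Product using (_×_; _,_; proj₁; proj₂; ∃)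
open import Data.Sum using (_⊎_; inj₁; inj₂)
open import Data.Empty using (⊥; ⊥-elim)
open import Relation.Nullary using (¬_; yes; no; contradiction)
open import Relation.Binary.PropositionalEquality using (_≢_; _≡_; refl)

increasing-head-least : ∀ {x d xs} → Increasing (x ∷ xs) → d ∈ xs → x < d
increasing-head-least (x<y ∷ _)   (here refl) = x<y
increasing-head-least (x<y ∷ inc) (there d∈)  = <-trans x<y (increasing-head-least inc d∈)

increasing-cons : ∀ {x xs} → (∀ d → d ∈ xs → x < d) → Increasing xs → Increasing (x ∷ xs)
increasing-cons {x} {[]}    _     _   = [ x ]
increasing-cons {x} {y ∷ _} below inc = below y (here refl) ∷ inc

A₂-disjoint : ∀ {n a b i j} → ArcA₂ n a b i j → b i < a j
A₂-disjoint (_ , _ , _ , _ , bi<aj , _) = bi<aj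

module IntervalModel (n : ℕ) (a b : ℕ → ℕ) (1≤n : 1 ≤ n)
  (wf : WellFormed n a b) (sorted : SortedLeft n a) (sentinels : Sentinels n a b) where

  InI⇒InI' : ∀ {k} → InI n k → InI' n k
  InI⇒InI' (_ , k≤n) = m≤n⇒m≤1+n k≤n

  a-mono : ∀ {i j} → InI' n i → InI' n j → i ≤ j → a i ≤ a j
  a-mono {i} {j} i∈ j∈ i≤j with m≤n⇒m<n∨m≡n i≤j
  ... | inj₁ i<j  = <⇒≤ (sorted i j i∈ j∈ i<j)
  ... | inj₂ refl = ≤-refl

  a-before-b : ∀ {i j} → InI' n i → InI' n j → i ≤ j → a i ≤ b j
  a-before-b i∈ j∈ i≤j = ≤-trans (a-mono i∈ j∈ i≤j) (wf _ j∈)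

  I₀-left : ∀ {k} → 1 ≤ k → k ≤ suc n → b 0 < a k
  I₀-left {k} 1≤k k≤n+1 with k ≤? n
  ... | yes k≤n = proj₁ (sentinels k (1≤k , k≤n))
  ... | no  _   = <-≤-trans (proj₁ (sentinels 1 (≤-refl , 1≤n)))
                            (a-mono (m≤n⇒m≤1+n 1≤n) k≤n+1 1≤k)

  Iₙ₊₁-right : ∀ {k} → k ≤ n → b k < a (suc n)
  Iₙ₊₁-right {zero}  _   = I₀-left (s≤s z≤n) ≤-refl
  Iₙ₊₁-right {suc k} k<n = proj₂ (sentinels (suc k) (s≤s z≤n , k<n))

  classify : ∀ {h} → InI' n h → h ≡ 0 ⊎ InI n h ⊎ h ≡ suc n
  classify {zero}  _ = inj₁ refl
  classify {suc h} h≤n+1 with suc h ≤? n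
  ... | yes h<n = inj₂ (inj₁ (s≤s z≤n , h<n))
  ... | no  h≮n = inj₂ (inj₂ (≤-antisym h≤n+1 (≰⇒> h≮n)))

  module Chosen (DS : List ℕ) (semitotal : SemitotalDominating n a b DS)
    (maximal : ∀ i j → i ∈ DS → InI n j → j ≢ i → ¬ Contained a b i j) where

    chosen-InI : ∀ {d} → d ∈ DS → InI n d
    chosen-InI = proj₁ semitotal _

    dominating : Dominating n a b DS
    dominating = proj₁ (proj₂ semitotal)

    partner : ∀ {y} → y ∈ DS → ∃ λ w → w ∈ DS × w ≢ y × Dist≤2 n a b y w
    partner = proj₂ (proj₂ semitotal) _

    data Anchor : ℕ → Set where
      left   : Anchor 0
      chosen : ∀ {p} → p ∈ DS → Anchor p
      right  : Anchor (suc n)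

    anchor-InI' : ∀ {p} → Anchor p → InI' n p
    anchor-InI' left       = z≤n
    anchor-InI' (chosen m) = InI⇒InI' (chosen-InI m)
    anchor-InI' right      = ≤-refl

    anchor-InV : ∀ {p} → Anchor p → InV n a b p
    anchor-InV anc = anchor-InI' anc , uncontained anc
      where
      uncontained : ∀ {p} → Anchor p → ∀ h → InI' n h → h ≢ p → ¬ Contained a b p h
      uncontained left h h∈ h≢0 (ah≤a0 , _) =
        <⇒≱ (sorted 0 h z≤n h∈ (n≢0⇒n>0 h≢0)) ah≤a0
      uncontained (chosen m) h h∈ h≢p c with classify h∈
      ... | inj₁ refl =
        <⇒≱ (I₀-left (proj₁ (chosen-InI m)) (anchor-InI' (chosen m)))
            (≤-trans (wf _ (anchor-InI' (chosen m))) (proj₂ c))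
      ... | inj₂ (inj₁ h∈I) = maximal _ h m h∈I h≢p c
      ... | inj₂ (inj₂ refl) =
        <⇒≱ (sorted _ (suc n) (anchor-InI' (chosen m)) ≤-refl (s≤s (proj₂ (chosen-InI m)))) (proj₁ c)
      uncontained right h h∈ h≢n+1 (_ , bn+1≤bh) with m≤n⇒m<n∨m≡n h∈
      ... | inj₂ h≡n+1     = h≢n+1 h≡n+1
      ... | inj₁ (s≤s h≤n) = <⇒≱ (Iₙ₊₁-right h≤n) (≤-trans (wf (suc n) ≤-refl) bn+1≤bh)

    ends-before : ∀ {w x} → InI n w → Anchor x → w ≤ x → b w ≤ b x
    ends-before (1≤w , _) left w≤0 = contradiction w≤0 (<⇒≱ 1≤w)
    ends-before {w} {x} w∈ (chosen m) w≤x with m≤n⇒m<n∨m≡n w≤x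
    ... | inj₂ refl = ≤-refl
    ... | inj₁ w<x  = ≮⇒≥ λ bx<bw →
      maximal x w m w∈ (<⇒≢ w<x) (a-mono (InI⇒InI' w∈) (anchor-InI' (chosen m)) w≤x , <⇒≤ bx<bw)
    ends-before w∈ right _ = <⇒≤ (<-≤-trans (Iₙ₊₁-right (proj₂ w∈)) (wf (suc n) ≤-refl))

    NoneBetween : ℕ → ℕ → Set
    NoneBetween p q = ∀ d → d ∈ DS → p < d → d < q → ⊥

    outside : ∀ {p q d} → NoneBetween p q → d ∈ DS → d ≤ p ⊎ q ≤ d
    outside {p} {q} {d} none d∈ with d ≤? p | q ≤? d
    ... | yes d≤p | _       = inj₁ d≤p
    ... | no  _   | yes q≤d = inj₂ q≤d
    ... | no  d≰p | no  q≰d = ⊥-elim (none d d∈ (≰⇒> d≰p) (≰⇒> q≰d))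

    -- If consecutive anchor intervals are disjoint, no interval of I' fits
    -- into the gap between them: it would not be dominated by DS.
    empty-gap : ∀ {p q} → Anchor p → Anchor q → NoneBetween p q →
                ∀ h → InI' n h → ¬ (b p < a h × b h < a q)
    empty-gap pa qa none h h∈ (bp<ah , bh<aq) with classify h∈
    ... | inj₁ refl = <⇒≱ bp<ah (a-before-b z≤n (anchor-InI' pa) z≤n)
    ... | inj₂ (inj₂ refl) = <⇒≱ bh<aq (a-before-b (anchor-InI' qa) h∈ (anchor-InI' qa))
    ... | inj₂ (inj₁ h∈I) with dominating h h∈I
    ...   | inj₁ h∈DS with outside none h∈DS
    ...     | inj₁ h≤p = <⇒≱ bp<ah (a-before-b h∈ (anchor-InI' pa) h≤p)
    ...     | inj₂ q≤h = <⇒≱ bh<aq (a-before-b (anchor-InI' qa) h∈ q≤h)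
    empty-gap pa qa none h h∈ (bp<ah , bh<aq) | inj₂ (inj₁ h∈I)
      | inj₂ (u , u∈DS , (u∈I , _ , _ , au≤bh , ah≤bu)) with outside none u∈DS
    ... | inj₁ u≤p = <⇒≱ bp<ah (≤-trans ah≤bu (ends-before u∈I pa u≤p))
    ... | inj₂ q≤u = <⇒≱ bh<aq (≤-trans (a-mono (anchor-InI' qa) (InI⇒InI' u∈I) q≤u) au≤bh)

    -- Overlapping anchors p < q form an A₁-arc; the sentinels overlap no
    -- other interval, so p and q both lie in I.
    overlap-arc : ∀ {p q} → Anchor p → Anchor q → p < q → a q ≤ b p → ArcA₁ n a b p q
    overlap-arc {p} {q} pa qa p<q aq≤bp =
      anchor-InV pa , anchor-InV qa , left-in-I pa , p<q , right-in-I qa ,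
      a-before-b (anchor-InI' pa) (anchor-InI' qa) (<⇒≤ p<q) , aq≤bp
      where
      left-in-I : Anchor p → 1 ≤ p
      left-in-I left       = contradiction aq≤bp (<⇒≱ (I₀-left p<q (anchor-InI' qa)))
      left-in-I (chosen m) = proj₁ (chosen-InI m)
      left-in-I right      = contradiction (anchor-InI' qa) (<⇒≱ p<q)
      right-in-I : Anchor q → q ≤ n
      right-in-I left       = contradiction z≤n (<⇒≱ p<q)
      right-in-I (chosen m) = proj₂ (chosen-InI m)
      right-in-I right      = contradiction aq≤bp (<⇒≱ (Iₙ₊₁-right (≤-pred p<q)))

    consecutive-arc : ∀ {p q} → Anchor p → Anchor q → p < q → NoneBetween p q → Arc n a b p q
    consecutive-arc {p} {q} pa qa p<q none with a q ≤? b p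
    ... | yes aq≤bp = inj₁ (overlap-arc pa qa p<q aq≤bp)
    ... | no  aq≰bp = inj₂ (anchor-InV pa , anchor-InV qa , p<q , anchor-InI' qa ,
                            ≰⇒> aq≰bp , empty-gap pa qa none)

    -- A semitotal partner w of y at or after the next anchor z marks the
    -- arc (y, z): the middle vertex of the y–w path overlaps both ends.
    partner-marks-right : ∀ {y z w} → Anchor z → b y < a z → InI n w → z ≤ w →
                          Dist≤2 n a b y w → Marked n a b y z
    partner-marks-right za by<az w∈ z≤w (inj₁ (_ , _ , _ , _ , aw≤by)) =
      contradiction (≤-trans (a-mono (anchor-InI' za) (InI⇒InI' w∈) z≤w) aw≤by) (<⇒≱ by<az)
    partner-marks-right za by<az w∈ z≤w
      (inj₂ (v , (_ , v∈ , _ , ay≤bv , av≤by) , (_ , _ , _ , _ , aw≤bv))) =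
      v , InI⇒InI' v∈ , (av≤by , ay≤bv) ,
      (≤-trans (<⇒≤ (≤-<-trans av≤by by<az)) (wf _ (anchor-InI' za)) ,
       ≤-trans (a-mono (anchor-InI' za) (InI⇒InI' w∈) z≤w) aw≤bv)

    partner-marks-left : ∀ {x y w} → Anchor x → b x < a y → InI n w → w ≤ x →
                         Dist≤2 n a b y w → Marked n a b x y
    partner-marks-left xa bx<ay w∈ w≤x (inj₁ (_ , _ , _ , ay≤bw , _)) =
      contradiction (≤-trans ay≤bw (ends-before w∈ xa w≤x)) (<⇒≱ bx<ay)
    partner-marks-left xa bx<ay w∈ w≤x
      (inj₂ (v , (_ , v∈ , _ , ay≤bv , av≤by) , (_ , _ , _ , av≤bw , _))) =
      v , InI⇒InI' v∈ ,
      (≤-trans av≤bw (ends-before w∈ xa w≤x) ,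
       ≤-trans (wf _ (anchor-InI' xa)) (≤-trans (<⇒≤ bx<ay) ay≤bv)) ,
      (av≤by , ay≤bv)

    no-two-unmarked : ∀ {x y z} → Anchor x → y ∈ DS → Anchor z →
                      NoneBetween x y → NoneBetween y z →
                      ¬ (Unmarked n a b x y × Unmarked n a b y z)
    no-two-unmarked xa y∈ za none-xy none-yz
      ((arc-xy , unmarked-xy) , (arc-yz , unmarked-yz))
      with partner y∈
    ... | w , w∈ , w≢y , y~w with outside none-xy w∈
    ...   | inj₁ w≤x = unmarked-xy
            (partner-marks-left xa (A₂-disjoint arc-xy) (chosen-InI w∈) w≤x y~w)
    ...   | inj₂ y≤w with outside none-yz w∈
    ...     | inj₁ w≤y = w≢y (≤-antisym w≤y y≤w)
    ...     | inj₂ z≤w = unmarked-yz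
            (partner-marks-right za (A₂-disjoint arc-yz) (chosen-InI w∈) z≤w y~w)

    next : List ℕ → ℕ
    next []      = suc n
    next (x ∷ _) = x

    record Walk (p : ℕ) (xs : List ℕ) : Set where
      field
        current    : Anchor p
        current≤n  : p ≤ n
        ahead      : ∀ d → d ∈ xs → d ∈ DS
        increasing : Increasing (p ∷ xs)
        covered    : ∀ d → d ∈ DS → d ≤ p ⊎ d ∈ xs
    open Walk

    start : Increasing DS → Walk 0 DS
    start inc = record
      { current    = left
      ; current≤n  = z≤n
      ; ahead      = λ _ d∈ → d∈
      ; increasing = increasing-cons (λ _ d∈ → proj₁ (chosen-InI d∈)) inc
      ; covered    = λ _ → inj₂
      }

    advance : ∀ {p x xs} → Walk p (x ∷ xs) → Walk x xs
    advance {p} {x} {xs} w = record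
      { current    = chosen x∈
      ; current≤n  = proj₂ (chosen-InI x∈)
      ; ahead      = λ d d∈ → ahead w d (there d∈)
      ; increasing = tail-increasing (increasing w)
      ; covered    = visited
      }
      where
      x∈ : x ∈ DS
      x∈ = ahead w x (here refl)
      tail-increasing : Increasing (p ∷ x ∷ xs) → Increasing (x ∷ xs)
      tail-increasing (_ ∷ inc) = inc
      p<x : p < x
      p<x = increasing-head-least (increasing w) (here refl)
      visited : ∀ d → d ∈ DS → d ≤ x ⊎ d ∈ xs
      visited d d∈ with covered w d d∈
      ... | inj₁ d≤p         = inj₁ (≤-trans d≤p (<⇒≤ p<x))
      ... | inj₂ (here refl) = inj₁ ≤-refl
      ... | inj₂ (there d∈′) = inj₂ d∈′

    next-anchor : ∀ {p xs} → Walk p xs → Anchor (next xs)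
    next-anchor {xs = []}    _ = right
    next-anchor {xs = x ∷ _} w = chosen (ahead w x (here refl))

    next-above : ∀ {p xs} → Walk p xs → p < next xs
    next-above {xs = []}    w = s≤s (current≤n w)
    next-above {xs = _ ∷ _} w = increasing-head-least (increasing w) (here refl)

    none-before-next : ∀ {p xs} → Walk p xs → NoneBetween p (next xs)
    none-before-next w d d∈ p<d d<next with covered w d d∈
    none-before-next w d d∈ p<d d<next | inj₁ d≤p = <⇒≱ p<d d≤p
    none-before-next {xs = _ ∷ _} w d d∈ p<d d<x | inj₂ (here refl) = <-irrefl refl d<x
    none-before-next {xs = _ ∷ _} w d d∈ p<d d<x | inj₂ (there d∈′) =
      <⇒≱ (increasing-head-least (increasing (advance w)) d∈′) (<⇒≤ d<x)

    walk-arc : ∀ {p xs} → Walk p xs → Arc n a b p (next xs)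
    walk-arc w = consecutive-arc (current w) (next-anchor w) (next-above w) (none-before-next w)

    walk-path : ∀ {p xs} → Walk p xs → IsPath n a b (p ∷ xs ++ suc n ∷ [])
    walk-path {xs = []}    w = cons (walk-arc w) (single (anchor-InV right))
    walk-path {xs = _ ∷ _} w = cons (walk-arc w) (walk-path (advance w))

    walk-triple : ∀ {p x xs} → Walk p (x ∷ xs) →
                  ¬ (Unmarked n a b p x × Unmarked n a b x (next xs))
    walk-triple w = no-two-unmarked (current w) (ahead w _ (here refl)) (next-anchor (advance w))
                      (none-before-next w) (none-before-next (advance w))

    walk-marked : ∀ {p xs} → Walk p xs → NoTwoUnmarked n a b (p ∷ xs ++ suc n ∷ [])
    walk-marked {xs = []}        _ = two _ _
    walk-marked {xs = _ ∷ []}    w = cons (walk-triple w) (two _ _)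
    walk-marked {xs = _ ∷ _ ∷ _} w = cons (walk-triple w) (walk-marked (advance w))

theorem6 : (n : ℕ) (a b : ℕ → ℕ) → 2 ≤ n →
    WellFormed n a b → DistinctEndpoints n a b → SortedLeft n a →
    Sentinels n a b → Connected n a b →
    (DS : List ℕ) → Increasing DS → SemitotalDominating n a b DS →
    (∀ i j → i ∈ DS → InI n j → j ≢ i → ¬ Contained a b i j) →
    IsPath n a b (0 ∷ DS ++ (suc n ∷ [])) × NoTwoUnmarked n a b (0 ∷ DS ++ (suc n ∷ []))
theorem6 n a b 2≤n wf _ sorted sentinels _ DS inc semitotal maximal =
  walk-path (start inc) , walk-marked (start inc)
  where
  open IntervalModel n a b (<⇒≤ 2≤n) wf sorted sentinels
  open Chosen DS semitotal maximal
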